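{- Let $\ell\ge 4$, $\kappa\ge 0$ and $\tau\ge 0$ be integers, and let $G$ be a graph with no hole of length at least $\ell$, such that $\chi(N^1_G(v))\le\kappa$ and $\chi(N^2_G(v))\le\tau$ for every vertex $v$. Then $\chi(G)\le 2(\ell-3)(\kappa+\tau)+1$.
   Context: Graphs are finite and simple. A hole is an induced subgraph that is a cycle of length at least four (length = number of edges). For $Y\subseteq V(G)$, $\chi(Y)$ is the chromatic number of $G[Y]$. For a vertex $v$, $N^1_G(v)$ is the set of neighbours of $v$, and $N^2_G(v)$ is the set of vertices different from $v$, nonadjacent to $v$, with a neighbour in $N^1_G(v)$ (i.e., the vertices at distance exactly two from $v$). -}

module Defs where

open import Data.Nat using (ℕ; suc; _+_; _∸_; _≤_; _≥_)
open import Data.Unit using (⊤)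
open import Data.Nat.DivMod using (_%_)
open import Data.Fin using (Fin; toℕ)
open import Data.Product using (Σ; _×_; ∃-syntax)
open import Data.Sum using (_⊎_)
open import Relation.Nullary using (¬_; Dec)
open import Relation.Binary.PropositionalEquality using (_≡_; _≢_)
open import Function.Definitions using (Injective)
open import Function.Bundles using (_⇔_)

record Graph (n : ℕ) : Set₁ where
  field
    Adj   : Fin n → Fin n → Set
    adj?  : ∀ u v → Dec (Adj u v)
    sym   : ∀ {u v} → Adj u v → Adj v u
    irrefl : ∀ {v} → ¬ Adj v v
open Graph public

VSet : ℕ → Set₁
VSet n = Fin n → Set

Colourable : ∀ {n} → Graph n → VSet n → ℕ → Set
Colourable {n} G Y k =
  Σ ((v : Fin n) → Y v → Fin k) λ c →
    ∀ u v (yu : Y u) (yv : Y v) → Adj G u v → c u yu ≢ c v yv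

χ≤ : ∀ {n} → Graph n → VSet n → ℕ → Set
χ≤ G Y k = Colourable G Y k

All : ∀ {n} → VSet n
All _ = ⊤

N1 : ∀ {n} → Graph n → Fin n → VSet n
N1 G v u = Adj G v u

N2 : ∀ {n} → Graph n → Fin n → VSet n
N2 G v u = (u ≢ v) × (¬ Adj G v u) × ∃[ w ] (Adj G v w × Adj G w u)

-- j is the cyclic successor of i in Z/mZ
CycSucc : ∀ {m} → Fin m → Fin m → Set
CycSucc {m} i j = (suc (toℕ i)) % (suc (m ∸ 1)) ≡ toℕ j

IsHole : ∀ {n} → Graph n → (m : ℕ) → (Fin m → Fin n) → Set
IsHole G m x =
  (m ≥ 4) × Injective _≡_ _≡_ x ×
  (∀ i j → Adj G (x i) (x j) ⇔ (CycSucc i j ⊎ CycSucc j i))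

NoLongHole : ∀ {n} → Graph n → ℕ → Set
NoLongHole G ℓ = ∀ m → m ≥ ℓ → (x : Fin m → _) → ¬ IsHole G m x

module Submission where

-- Colour each component by the breadth-first levels around a root r. Adjacent vertices lie
-- on the same or on consecutive levels, so r gets one colour and the levels alternate between
-- two palettes of X = (ℓ − 3)(κ + τ) colours; it remains to colour each level with X colours.
-- Level 1 lies in N¹(r). For z on level k + 2, start a trail at the chosen parent a of z and
-- extend it inside level k + 2 by canonical steps, always staying in the part of z's component
-- that avoids the neighbourhood of the trail. If the current trail vertex p_i sees z, z gets
-- colour χ(N¹(p_i)) from block i. After ℓ − 3 steps some trail vertex p_i is at distance two
-- from z, and z gets colour χ(N²(p_i)) from block i: otherwise the trail, the parent of z and a
-- path through the lower levels to the parent of a would contain a hole of length at least ℓ.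
-- Adjacent vertices follow the same trail until the current vertex sees one of them, so their
-- colours differ.

open import Defs
open import Level using (0ℓ)
open import Data.Nat using (ℕ; zero; suc; _+_; _*_; _∸_; _≥_; _≤_; _<_; z≤n; s≤s; _%_)
open import Data.Nat.Properties
open import Data.Nat.Tactic.RingSolver using (solve-∀)
open import Data.Nat.DivMod using (m<n⇒m%n≡m; n%n≡0)
open import Data.Fin as F using (Fin; toℕ)
import Data.Fin.Properties as FinP
open import Data.Maybe as Maybe using (Maybe; just; nothing; fromMaybe)
open import Data.List using (List; []; _∷_; _++_; length; lookup; last; head; [_])
open import Data.List.Properties using (++-assoc; length-++; length-++-≤ʳ)
open import Data.List.Relation.Unary.All as ListAll using ([]; _∷_) renaming (All to ListAll)
import Data.List.Relation.Unary.All.Properties as ListAllP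
open import Data.List.Relation.Unary.Any as Any using (Any; here; there)
open import Data.List.Relation.Unary.First as First using (FirstView)
open import Data.List.Relation.Unary.First.Properties using (toView)
open import Data.List.Membership.Propositional.Properties using (∈-lookup)
open import Data.Product as Product using (∃; _×_; _,_; proj₁; proj₂)
open import Data.Sum as Sum using (_⊎_; inj₁; inj₂)
open import Data.Sum.Properties using (inj₁-injective; inj₂-injective)
open import Data.Unit using (⊤; tt)
open import Data.Empty using (⊥; ⊥-elim)
open import Function using (_∘_)
open import Function.Bundles using (mk⇔)
open import Function.Definitions using (Injective)
open import Relation.Binary using (tri<; tri≈; tri>)
open import Relation.Nullary using (¬_; Dec; yes; no)
open import Relation.Nullary.Decidable using (_×-dec_; _⊎-dec_; ¬?; toSum)
open import Relation.Unary using (Pred; Decidable; _⊆_; ∁)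
import Relation.Binary.PropositionalEquality as Eq
open Eq using (_≡_; _≢_; refl; trans; cong; cong₂; subst)

search : ∀ {m} {P : Pred (Fin m) 0ℓ} → Decidable P → Maybe (Fin m)
search {zero}  P? = nothing
search {suc m} P? with P? F.zero
... | yes _ = just F.zero
... | no  _ = Maybe.map F.suc (search (P? ∘ F.suc))

search-complete : ∀ {m} {P : Pred (Fin m) 0ℓ} (P? : Decidable P) {x} → P x →
                  ∃ λ y → search P? ≡ just y × P y
search-complete {suc m} P? {x} px with P? F.zero
... | yes p₀ = F.zero , refl , p₀
search-complete {suc m} P? {F.zero}  px | no ¬p₀ = ⊥-elim (¬p₀ px)
search-complete {suc m} P? {F.suc x} px | no ¬p₀ with search-complete (P? ∘ F.suc) px
... | y , eq , py = F.suc y , cong (Maybe.map F.suc) eq , py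

search-cong : ∀ {m} {P Q : Pred (Fin m) 0ℓ} (P? : Decidable P) (Q? : Decidable Q) →
              P ⊆ Q → Q ⊆ P → search P? ≡ search Q?
search-cong {zero}  P? Q? P⊆Q Q⊆P = refl
search-cong {suc m} P? Q? P⊆Q Q⊆P with P? F.zero | Q? F.zero
... | yes _  | yes _  = refl
... | yes p  | no ¬q  = ⊥-elim (¬q (P⊆Q p))
... | no ¬p  | yes q  = ⊥-elim (¬p (Q⊆P q))
... | no _   | no _   = cong (Maybe.map F.suc) (search-cong (P? ∘ F.suc) (Q? ∘ F.suc) P⊆Q Q⊆P)

-- The first element satisfying P, or the junk default d if there is none.
choose : ∀ {m} {P : Pred (Fin m) 0ℓ} → Fin m → Decidable P → Fin m
choose d P? = fromMaybe d (search P?)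

choose-satisfies : ∀ {m} {P : Pred (Fin m) 0ℓ} d (P? : Decidable P) {x} → P x → P (choose d P?)
choose-satisfies d P? px with search-complete P? px
... | y , eq , py rewrite eq = py

choose-cong : ∀ {m} {P Q : Pred (Fin m) 0ℓ} d d′ (P? : Decidable P) (Q? : Decidable Q) {x} → P x →
              P ⊆ Q → Q ⊆ P → choose d P? ≡ choose d′ Q?
choose-cong d d′ P? Q? px P⊆Q Q⊆P with search-complete P? px | search-cong P? Q? P⊆Q Q⊆P
... | y , eq , _ | eq′ rewrite eq | Eq.sym eq′ = refl

least : ∀ {P : Pred ℕ 0ℓ} → Decidable P → ℕ → ℕ
least P? zero = zero
least P? (suc N) with P? zero
... | yes _ = zero
... | no  _ = suc (least (P? ∘ suc) N)

least-minimal : ∀ {P : Pred ℕ 0ℓ} (P? : Decidable P) N {j} → P j → j ≤ N →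
                P (least P? N) × least P? N ≤ j
least-minimal P? zero {zero} pj z≤n = pj , z≤n
least-minimal P? (suc N) {j} pj j≤N with P? zero
... | yes p₀ = p₀ , z≤n
least-minimal P? (suc N) {zero}  pj _         | no ¬p₀ = ⊥-elim (¬p₀ pj)
least-minimal P? (suc N) {suc j} pj (s≤s j≤N) | no ¬p₀ =
  Product.map₂ s≤s (least-minimal (P? ∘ suc) N pj j≤N)

least≤bound : ∀ {P : Pred ℕ 0ℓ} (P? : Decidable P) N → least P? N ≤ N
least≤bound P? zero = z≤n
least≤bound P? (suc N) with P? zero
... | yes _ = z≤n
... | no  _ = s≤s (least≤bound (P? ∘ suc) N)

firstView : ∀ {A : Set} {P : Pred A 0ℓ} → Decidable P → ∀ {xs} → Any P xs → FirstView (∁ P) P xs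
firstView P? any = toView (First.refine (λ {x} _ → toSum (P? x)) (First.fromAny any))

length-∷ʳ : ∀ {A : Set} (xs : List A) x → length (xs ++ [ x ]) ≡ suc (length xs)
length-∷ʳ []       x = refl
length-∷ʳ (_ ∷ xs) x = cong suc (length-∷ʳ xs x)

all-through : ∀ {A : Set} {P : Pred A 0ℓ} xs {h ys} → ListAll P (xs ++ h ∷ ys) → ListAll P (xs ++ [ h ])
all-through xs ps = ListAllP.++⁺ (ListAllP.++⁻ˡ xs ps) (ListAll.head (ListAllP.++⁻ʳ xs ps) ∷ [])

all-∷ʳ : ∀ {A : Set} {P : Pred A 0ℓ} xs {c x} → ListAll P (xs ++ [ c ]) → P x → ListAll P (xs ++ c ∷ [ x ])
all-∷ʳ []       (pc ∷ []) px = pc ∷ px ∷ []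
all-∷ʳ (_ ∷ xs) (py ∷ ps) px = py ∷ all-∷ʳ xs ps px

last-∷ʳ : ∀ {A : Set} (xs : List A) z → last (xs ++ [ z ]) ≡ just z
last-∷ʳ []           z = refl
last-∷ʳ (x ∷ [])     z = refl
last-∷ʳ (x ∷ y ∷ xs) z = last-∷ʳ (y ∷ xs) z

last-any : ∀ {A : Set} {P : Pred A 0ℓ} {z} xs → last xs ≡ just z → P z → Any P xs
last-any (x ∷ [])     refl pz = here pz
last-any (x ∷ y ∷ xs) eq   pz = there (last-any (y ∷ xs) eq pz)

last-any-tail : ∀ {A : Set} {P : Pred A 0ℓ} {c z} xs → ¬ P c → last (c ∷ xs) ≡ just z → P z → Any P xs
last-any-tail []       ¬pc refl pz = ⊥-elim (¬pc pz)
last-any-tail (x ∷ xs) _   eq   pz = last-any (x ∷ xs) eq pz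

head-∷ʳ-≢ : ∀ {A : Set} xs {h c : A} → head (xs ++ [ h ]) ≡ just c → h ≢ c → 1 ≤ length xs
head-∷ʳ-≢ []      refl h≢c = ⊥-elim (h≢c refl)
head-∷ʳ-≢ (_ ∷ _) _    _   = s≤s z≤n

lookup-all : ∀ {A : Set} {P : Pred A 0ℓ} {xs} → ListAll P xs → (i : Fin (length xs)) → P (lookup xs i)
lookup-all ps i = ListAll.lookup ps (∈-lookup i)

lookup-∷ʳ : ∀ {A : Set} {P : Pred A 0ℓ} ys w → ListAll P ys → (j : Fin (length (ys ++ [ w ]))) →
            (suc (toℕ j) ≡ length (ys ++ [ w ]) × lookup (ys ++ [ w ]) j ≡ w) ⊎
            (suc (toℕ j) ≢ length (ys ++ [ w ]) × P (lookup (ys ++ [ w ]) j))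
lookup-∷ʳ []       w []         F.zero    = inj₁ (refl , refl)
lookup-∷ʳ (y ∷ ys) w (py ∷ pys) F.zero    =
  inj₂ ((λ eq → 0≢1+n (trans (suc-injective eq) (length-∷ʳ ys w))) , py)
lookup-∷ʳ (y ∷ ys) w (py ∷ pys) (F.suc j) =
  Sum.map (Product.map₁ (cong suc)) (Product.map₁ (λ ne eq → ne (suc-injective eq))) (lookup-∷ʳ ys w pys j)

join-injective : ∀ m k {a b : Fin m ⊎ Fin k} → F.join m k a ≡ F.join m k b → a ≡ b
join-injective m k {a} {b} eq =
  trans (Eq.sym (FinP.splitAt-join m k a)) (trans (cong (F.splitAt m) eq) (FinP.splitAt-join m k b))

swap-injective : ∀ {A B : Set} {x y : A ⊎ B} → Sum.swap x ≡ Sum.swap y → x ≡ y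
swap-injective {x = inj₁ _} {inj₁ _} refl = refl
swap-injective {x = inj₂ _} {inj₂ _} refl = refl

alternate : ∀ {A : Set} → ℕ → A → A ⊎ A
alternate zero    = inj₁
alternate (suc j) = Sum.swap ∘ alternate j

alternate-injective : ∀ {A : Set} j {a b : A} → alternate j a ≡ alternate j b → a ≡ b
alternate-injective zero    refl = refl
alternate-injective (suc j) eq   = alternate-injective j (swap-injective eq)

alternate-≢ : ∀ {A : Set} j {a b : A} → alternate j a ≢ alternate (suc j) b
alternate-≢ zero    ()
alternate-≢ (suc j) eq = alternate-≢ j (swap-injective eq)

cast-injective : ∀ {i j} .(eq : i ≡ j) {x y : Fin i} → F.cast eq x ≡ F.cast eq y → x ≡ y
cast-injective eq {x} {y} e =
  FinP.toℕ-injective (trans (Eq.sym (FinP.toℕ-cast eq x)) (trans (cong toℕ e) (FinP.toℕ-cast eq y)))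


module Paths {n : ℕ} (G : Graph n) where

  V : Set
  V = Fin n

  infix 4 _~_
  _~_ : V → V → Set
  u ~ v = Adj G u v

  ~-sym : ∀ {u v} → u ~ v → v ~ u
  ~-sym = Graph.sym G

  ~⇒≢ : ∀ {u v} → u ~ v → u ≢ v
  ~⇒≢ u~v refl = irrefl G u~v

  Apart : V → V → Set
  Apart u v = u ≢ v × ¬ u ~ v

  apart? : ∀ u v → Dec (Apart u v)
  apart? u v = ¬? (u F.≟ v) ×-dec ¬? (adj? G u v)

  n2? : ∀ p z → Dec (N2 G p z)
  n2? p z = ¬? (z F.≟ p) ×-dec (¬? (adj? G p z) ×-dec FinP.any? (λ w → adj? G p w ×-dec adj? G w z))

  apart-from-neighbour : ∀ {p q z} → Apart p z → ¬ N2 G p z → q ~ z → Apart p q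
  apart-from-neighbour (p≢z , p≁z) ¬N2 q~z =
    (λ { refl → p≁z q~z }) , (λ p~q → ¬N2 ((λ z≡p → p≢z (Eq.sym z≡p)) , p≁z , _ , p~q , q~z))

  Induced : List V → Set
  Induced []           = ⊤
  Induced (x ∷ [])     = ⊤
  Induced (x ∷ y ∷ ys) = x ~ y × ListAll (Apart x) ys × Induced (y ∷ ys)

  induced-++⁻ˡ : ∀ xs {ys} → Induced (xs ++ ys) → Induced xs
  induced-++⁻ˡ []           _                 = tt
  induced-++⁻ˡ (x ∷ [])     _                 = tt
  induced-++⁻ˡ (x ∷ y ∷ xs) (x~y , x# , ind) = x~y , ListAllP.++⁻ˡ xs x# , induced-++⁻ˡ (y ∷ xs) ind

  induced-through : ∀ L xs {h ys} → Induced (L ++ xs ++ h ∷ ys) → Induced (L ++ xs ++ [ h ])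
  induced-through L xs {h} {ys} ind =
    induced-++⁻ˡ (L ++ xs ++ [ h ])
      (subst Induced (Eq.sym (trans (++-assoc L (xs ++ [ h ]) ys) (cong (L ++_) (++-assoc xs [ h ] ys)))) ind)

  induced-∷ʳ : ∀ xs {c x} → Induced (xs ++ [ c ]) → ListAll (λ p → Apart p x) xs → c ~ x →
               Induced (xs ++ c ∷ [ x ])
  induced-∷ʳ []           _                    _            c~x = c~x , [] , tt
  induced-∷ʳ (p ∷ [])     (p~c , _ , _)        (p#x ∷ [])   c~x = p~c , p#x ∷ [] , c~x , [] , tt
  induced-∷ʳ (p ∷ q ∷ xs) (p~q , p# , ind)     (p#x ∷ p#s)  c~x =
    p~q , all-∷ʳ xs p# p#x , induced-∷ʳ (q ∷ xs) ind p#s c~x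

  induced-++-∷ʳ : ∀ L xs {c x} → Induced (L ++ xs ++ [ c ]) → ListAll (λ p → Apart p x) (L ++ xs) → c ~ x →
                  Induced (L ++ xs ++ c ∷ [ x ])
  induced-++-∷ʳ L xs {c} {x} ind L#x c~x =
    subst Induced (++-assoc L xs (c ∷ [ x ]))
      (induced-∷ʳ (L ++ xs) (subst Induced (Eq.sym (++-assoc L xs [ c ])) ind) L#x c~x)

  induced-adjacent : ∀ xs → Induced xs → (i j : Fin (length xs)) → lookup xs i ~ lookup xs j →
                     toℕ j ≡ suc (toℕ i) ⊎ toℕ i ≡ suc (toℕ j)
  induced-adjacent (x ∷ [])     _            F.zero F.zero x~x = ⊥-elim (irrefl G x~x)
  induced-adjacent (x ∷ y ∷ ys) _            F.zero F.zero x~x = ⊥-elim (irrefl G x~x)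
  induced-adjacent (x ∷ y ∷ ys) _            F.zero (F.suc F.zero) _ = inj₁ refl
  induced-adjacent (x ∷ y ∷ ys) (_ , x# , _) F.zero (F.suc (F.suc j)) x~ = ⊥-elim (proj₂ (lookup-all x# j) x~)
  induced-adjacent (x ∷ y ∷ ys) _            (F.suc F.zero) F.zero _ = inj₂ refl
  induced-adjacent (x ∷ y ∷ ys) (_ , x# , _) (F.suc (F.suc i)) F.zero ~x =
    ⊥-elim (proj₂ (lookup-all x# i) (~-sym ~x))
  induced-adjacent (x ∷ y ∷ ys) (_ , _ , ind) (F.suc i) (F.suc j) a =
    Sum.map (cong suc) (cong suc) (induced-adjacent (y ∷ ys) ind i j a)

  induced-consecutive : ∀ xs → Induced xs → (i j : Fin (length xs)) → toℕ j ≡ suc (toℕ i) →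
                        lookup xs i ~ lookup xs j
  induced-consecutive (x ∷ y ∷ ys) (x~y , _ , _) F.zero (F.suc F.zero) _ = x~y
  induced-consecutive (x ∷ y ∷ ys) (_ , _ , ind) (F.suc i) (F.suc j) eq =
    induced-consecutive (y ∷ ys) ind i j (suc-injective eq)

  lookup-injective : ∀ xs → Induced xs → (i j : Fin (length xs)) → lookup xs i ≡ lookup xs j → i ≡ j
  lookup-injective (x ∷ [])     _             F.zero F.zero _ = refl
  lookup-injective (x ∷ y ∷ ys) _             F.zero F.zero _ = refl
  lookup-injective (x ∷ y ∷ ys) (x~y , _ , _) F.zero (F.suc F.zero) eq = ⊥-elim (~⇒≢ x~y eq)
  lookup-injective (x ∷ y ∷ ys) (_ , x# , _)  F.zero (F.suc (F.suc j)) eq = ⊥-elim (proj₁ (lookup-all x# j) eq)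
  lookup-injective (x ∷ y ∷ ys) (x~y , _ , _) (F.suc F.zero) F.zero eq = ⊥-elim (~⇒≢ x~y (Eq.sym eq))
  lookup-injective (x ∷ y ∷ ys) (_ , x# , _)  (F.suc (F.suc i)) F.zero eq =
    ⊥-elim (proj₁ (lookup-all x# i) (Eq.sym eq))
  lookup-injective (x ∷ y ∷ ys) (_ , _ , ind) (F.suc i) (F.suc j) eq =
    cong F.suc (lookup-injective (y ∷ ys) ind i j eq)

  induced-length : ∀ xs → Induced xs → length xs ≤ n
  induced-length xs ind with length xs ≤? n
  ... | yes ≤n = ≤n
  ... | no  ≰n with FinP.pigeonhole (≰⇒> ≰n) (lookup xs)
  ...   | i , j , i<j , eq = ⊥-elim (FinP.<-irrefl (lookup-injective xs ind i j eq) i<j)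


  -- z is reached from u in at most j steps through vertices in R (u itself need not lie in R).
  Reach : Pred V 0ℓ → V → ℕ → V → Set
  Reach R u zero    z = u ≡ z
  Reach R u (suc j) z = Reach R u j z ⊎ (R z × ∃ λ w → Reach R u j w × w ~ z)

  reach? : ∀ {R} → Decidable R → ∀ u j z → Dec (Reach R u j z)
  reach? R? u zero    z = u F.≟ z
  reach? R? u (suc j) z =
    reach? R? u j z ⊎-dec (R? z ×-dec FinP.any? (λ w → reach? R? u j w ×-dec adj? G w z))

  reach-mono : ∀ {R u z i j} → i ≤ j → Reach R u i z → Reach R u j z
  reach-mono {j = zero}          z≤n       r = r
  reach-mono {i = zero}  {suc j} z≤n       r = inj₁ (reach-mono z≤n r)
  reach-mono {i = suc i} {suc j} (s≤s i≤j) (inj₁ r) = inj₁ (reach-mono i≤j r)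
  reach-mono {i = suc i} {suc j} (s≤s i≤j) (inj₂ (z∈R , w , r , w~z)) = inj₂ (z∈R , w , reach-mono i≤j r , w~z)

  reach-start : ∀ {R u z} j → Reach R u j z → u ≡ z ⊎ R z
  reach-start zero    eq                = inj₁ eq
  reach-start (suc j) (inj₁ r)          = reach-start j r
  reach-start (suc j) (inj₂ (z∈R , _)) = inj₂ z∈R

  reach-∷ : ∀ {R u y z} → u ~ y → R y → ∀ j → Reach R y j z → Reach R u (suc j) z
  reach-∷ u~y y∈R zero    refl     = inj₂ (y∈R , _ , refl , u~y)
  reach-∷ u~y y∈R (suc j) (inj₁ r) = inj₁ (reach-∷ u~y y∈R j r)
  reach-∷ u~y y∈R (suc j) (inj₂ (z∈R , w , r , w~z)) = inj₂ (z∈R , w , reach-∷ u~y y∈R j r , w~z)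

  reach-++ : ∀ {R u w z} i j → Reach R u i w → Reach R w j z → Reach R u (j + i) z
  reach-++ i zero    r refl      = r
  reach-++ i (suc j) r (inj₁ r′) = inj₁ (reach-++ i j r r′)
  reach-++ i (suc j) r (inj₂ (z∈R , w , r′ , w~z)) = inj₂ (z∈R , w , reach-++ i j r r′ , w~z)

  route-reach : ∀ {R} c via {z} → Induced (c ∷ via) → ListAll R via → last (c ∷ via) ≡ just z →
                Reach R c (length via) z
  route-reach c []       _               _          refl = refl
  route-reach c (y ∷ ys) (c~y , _ , ind) (y∈R ∷ ys∈R) end =
    reach-∷ c~y y∈R (length ys) (route-reach y ys ind ys∈R end)

  record Route (R : Pred V 0ℓ) (L : List V) (c z : V) : Set where
    constructor route
    field
      via     : List V
      induced : Induced (L ++ c ∷ via)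
      inside  : ListAll R via
      ends    : last (c ∷ via) ≡ just z

  Hit : V → Pred V 0ℓ
  Hit z p = p ≡ z ⊎ p ~ z

  hit? : ∀ z → Decidable (Hit z)
  hit? z p = (p F.≟ z) ⊎-dec adj? G p z

  -- An R-walk from c is shortened to an induced path by jumping to the target z
  -- from the first vertex that hits it.
  route-to : ∀ {R} L c → (∀ {y} → R y → ListAll (λ p → Apart p y) L) → Induced (L ++ [ c ]) →
             ∀ j {z} → Reach R c j z → Route R L c z
  route-to L c L#R ind zero    refl     = route [] ind [] refl
  route-to L c L#R ind (suc j) (inj₁ r) = route-to L c L#R ind j r
  route-to {R} L c L#R ind (suc j) {z} (inj₂ (z∈R , w , r , w~z)) = shortcut (route-to L c L#R ind j r)
    where
      miss⇒apart : ∀ {p} → ¬ Hit z p → Apart p z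
      miss⇒apart miss = (λ eq → miss (inj₁ eq)) , (λ p~z → miss (inj₂ p~z))

      shortcut : Route R L c w → Route R L c z
      shortcut (route via ind′ via∈R end) with hit? z c
      ... | yes (inj₁ refl) = route [] (induced-through L [] ind′) [] refl
      ... | yes (inj₂ c~z)  = route [ z ] (induced-∷ʳ L (induced-through L [] ind′) (L#R z∈R) c~z) (z∈R ∷ []) refl
      ... | no c-miss with firstView (hit? z) (last-any-tail via c-miss end (inj₂ w~z))
      ... | First._++_∷_ {T} misses (inj₁ refl) T₂ =
        route (T ++ [ z ]) (induced-through L (c ∷ T) ind′) (all-through T via∈R) (last-∷ʳ (c ∷ T) z)
      ... | First._++_∷_ {T} {h} misses (inj₂ h~z) T₂ =
        route (T ++ h ∷ [ z ])
              (induced-++-∷ʳ L (c ∷ T) (induced-through L (c ∷ T) ind′)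
                (ListAllP.++⁺ (L#R z∈R) (miss⇒apart c-miss ∷ ListAll.map miss⇒apart misses)) h~z)
              (all-∷ʳ T (all-through T via∈R) z∈R)
              (subst (λ xs → last xs ≡ just z) (++-assoc (c ∷ T) [ h ] [ z ]) (last-∷ʳ (c ∷ T ++ [ h ]) z))

  reach-≤n : ∀ {R} u j {z} → Reach R u j z → Reach R u n z
  reach-≤n u j r with route-to [] u (λ _ → []) tt j r
  ... | route via ind via∈R end =
    reach-mono (≤-trans (n≤1+n _) (induced-length (u ∷ via) ind)) (route-reach u via ind via∈R end)

  record Approach (R : Pred V 0ℓ) (L : List V) (c t : V) : Set where
    constructor approach
    field
      before    : List V
      neighbour : V
      induced   : Induced (L ++ before ++ [ neighbour ])
      starts    : head (before ++ [ neighbour ]) ≡ just c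
      inside    : ListAll R (before ++ [ neighbour ])
      misses    : ListAll (λ p → ¬ p ~ t) before
      adjacent  : neighbour ~ t

  approach-to : ∀ {R R′ : Pred V 0ℓ} {L c z t} → R ⊆ R′ → R′ c → Route R L c z → z ~ t → Approach R′ L c t
  approach-to {L = L} {c} {t = t} R⊆R′ c∈R′ (route via ind via∈R end) z~t with adj? G c t
  ... | yes c~t = approach [] c (induced-through L [] ind) refl (c∈R′ ∷ []) [] c~t
  ... | no c≁t with firstView (λ p → adj? G p t) (last-any-tail via c≁t end z~t)
  ... | First._++_∷_ {T} {h} misses h~t T₂ =
    approach (c ∷ T) h (induced-through L (c ∷ T) ind) refl
             (c∈R′ ∷ ListAll.map R⊆R′ (all-through T via∈R)) (c≁t ∷ misses) h~t

module Levels {n : ℕ} (G : Graph n) where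
  open Paths G

  Within : V → ℕ → V → Set
  Within = Reach (λ _ → ⊤)

  within? : ∀ r j z → Dec (Within r j z)
  within? = reach? (λ _ → yes tt)

  Connected : V → V → Set
  Connected r = Within r n

  dist : V → V → ℕ
  dist r z = least (λ j → within? r j z) n

  Level : V → ℕ → V → Set
  Level r k z = Connected r z × dist r z ≡ k

  level? : ∀ r k z → Dec (Level r k z)
  level? r k z = within? r n z ×-dec (dist r z ≟ k)

  dist-minimal : ∀ r j z → Within r j z → Within r (dist r z) z × dist r z ≤ j
  dist-minimal r j z w with j ≤? n
  ... | yes j≤n = least-minimal (λ j → within? r j z) n w j≤n
  ... | no  j≰n = proj₁ (least-minimal (λ j → within? r j z) n (reach-≤n r j w) ≤-refl) ,
                  ≤-trans (least≤bound (λ j → within? r j z) n) (<⇒≤ (≰⇒> j≰n))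

  level-of : ∀ r z → Connected r z → Level r (dist r z) z
  level-of r z c = c , refl

  level-within : ∀ {r k z} → Level r k z → Within r k z
  level-within {r} {z = z} (c , refl) = proj₁ (dist-minimal r n z c)

  level-zero : ∀ {r z} → Level r 0 z → r ≡ z
  level-zero = level-within

  level-unique : ∀ {r j j′ v} → Level r j v → Level r j′ v → j ≡ j′
  level-unique (_ , refl) (_ , refl) = refl

  level-~ : ∀ {r j u v} → Level r j u → u ~ v → Connected r v × dist r v ≤ suc j
  level-~ {r} {j} {u} {v} lu u~v = reach-≤n r (suc j) wv , proj₂ (dist-minimal r (suc j) v wv)
    where
      wv : Within r (suc j) v
      wv = inj₂ (tt , u , level-within lu , u~v)

  level-~≤ : ∀ {r j j′ u v} → Level r j u → Level r j′ v → u ~ v → j′ ≤ suc j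
  level-~≤ lu (_ , refl) u~v = proj₂ (level-~ lu u~v)

  level-parent : ∀ {r j v} → Level r (suc j) v → ∃ λ p → Level r j p × p ~ v
  level-parent {r} {j} {v} lv@(_ , dv) with level-within lv
  ... | inj₁ w = ⊥-elim (1+n≰n (subst (_≤ j) dv (proj₂ (dist-minimal r j v w))))
  ... | inj₂ (_ , p , w , p~v) = p , (reach-≤n r j w , dp≡j) , p~v
    where
      dp≤j : dist r p ≤ j
      dp≤j = proj₂ (dist-minimal r j p w)
      dp≡j : dist r p ≡ j
      dp≡j = ≤-antisym dp≤j (≤-pred (subst (_≤ suc (dist r p)) dv
               (proj₂ (level-~ (level-of r p (reach-≤n r j w)) p~v))))

  level-one : ∀ {r z} → Level r 1 z → r ~ z
  level-one lz with level-parent lz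
  ... | p , lp , p~z = subst (_~ _) (Eq.sym (level-zero lp)) p~z

cycSucc-inv : ∀ {L} (i j : Fin (suc L)) → CycSucc i j →
              toℕ j ≡ suc (toℕ i) ⊎ (suc (toℕ i) ≡ suc L × toℕ j ≡ 0)
cycSucc-inv {L} i j cs with suc (toℕ i) <? suc L
... | yes i+1<L+1 = inj₁ (trans (Eq.sym cs) (m<n⇒m%n≡m i+1<L+1))
... | no  i+1≮L+1 = inj₂ (i+1≡L+1 , trans (Eq.sym cs) (trans (cong (_% suc L) i+1≡L+1) (n%n≡0 (suc L))))
  where
    i+1≡L+1 : suc (toℕ i) ≡ suc L
    i+1≡L+1 = ≤-antisym (FinP.toℕ<n i) (≮⇒≥ i+1≮L+1)

next⇒cycSucc : ∀ {L} (i j : Fin (suc L)) → toℕ j ≡ suc (toℕ i) → CycSucc i j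
next⇒cycSucc {L} i j eq = trans (m<n⇒m%n≡m (subst (_< suc L) eq (FinP.toℕ<n j))) (Eq.sym eq)

wrap⇒cycSucc : ∀ {L} (i j : Fin (suc L)) → suc (toℕ i) ≡ suc L → toℕ j ≡ 0 → CycSucc i j
wrap⇒cycSucc {L} i j eq j≡0 = trans (cong (_% suc L) eq) (trans (n%n≡0 (suc L)) (Eq.sym j≡0))

module Holes {n : ℕ} (G : Graph n) where
  open Paths G

  module _ {v y w : V} (ys : List V) (ind : Induced (y ∷ ys ++ [ w ])) (v~y : v ~ y) (v~w : v ~ w)
           (v#ys : ListAll (Apart v) ys) (ys≢[] : 1 ≤ length ys) where

    path : List V
    path = y ∷ ys ++ [ w ]

    cycle : List V
    cycle = v ∷ path

    v~⇒end : (j : Fin (length path)) → v ~ lookup path j → toℕ j ≡ 0 ⊎ suc (toℕ j) ≡ length path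
    v~⇒end F.zero    _ = inj₁ refl
    v~⇒end (F.suc j) v~ with lookup-∷ʳ ys w v#ys j
    ... | inj₁ (eq , _)      = inj₂ (cong suc eq)
    ... | inj₂ (_ , (_ , ≁)) = ⊥-elim (≁ v~)

    end⇒v~ : (j : Fin (length path)) → toℕ j ≡ 0 ⊎ suc (toℕ j) ≡ length path → v ~ lookup path j
    end⇒v~ F.zero    _          = v~y
    end⇒v~ (F.suc j) (inj₂ eq) with lookup-∷ʳ ys w v#ys j
    ... | inj₁ (_ , lj≡w) = subst (v ~_) (Eq.sym lj≡w) v~w
    ... | inj₂ (ne , _)   = ⊥-elim (ne (suc-injective eq))

    v∉path : (j : Fin (length path)) → v ≢ lookup path j
    v∉path F.zero = ~⇒≢ v~y
    v∉path (F.suc j) with lookup-∷ʳ ys w v#ys j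
    ... | inj₁ (_ , lj≡w)    = λ eq → ~⇒≢ v~w (trans eq lj≡w)
    ... | inj₂ (_ , (≢ , _)) = ≢

    ~⇒cycSucc : ∀ i j → lookup cycle i ~ lookup cycle j → CycSucc i j ⊎ CycSucc j i
    ~⇒cycSucc F.zero F.zero x~x = ⊥-elim (irrefl G x~x)
    ~⇒cycSucc F.zero (F.suc j) v~ with v~⇒end j v~
    ... | inj₁ eq = inj₁ (next⇒cycSucc F.zero (F.suc j) (cong suc eq))
    ... | inj₂ eq = inj₂ (wrap⇒cycSucc (F.suc j) F.zero (cong suc eq) refl)
    ~⇒cycSucc (F.suc i) F.zero ~v with v~⇒end i (~-sym ~v)
    ... | inj₁ eq = inj₂ (next⇒cycSucc F.zero (F.suc i) (cong suc eq))
    ... | inj₂ eq = inj₁ (wrap⇒cycSucc (F.suc i) F.zero (cong suc eq) refl)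
    ~⇒cycSucc (F.suc i) (F.suc j) a with induced-adjacent path ind i j a
    ... | inj₁ eq = inj₁ (next⇒cycSucc (F.suc i) (F.suc j) (cong suc eq))
    ... | inj₂ eq = inj₂ (next⇒cycSucc (F.suc j) (F.suc i) (cong suc eq))

    cycSucc⇒~ : ∀ i j → CycSucc i j → lookup cycle i ~ lookup cycle j
    cycSucc⇒~ i j cs with cycSucc-inv i j cs
    cycSucc⇒~ F.zero    F.zero    _ | inj₁ ()
    cycSucc⇒~ F.zero    (F.suc j) _ | inj₁ eq = end⇒v~ j (inj₁ (suc-injective eq))
    cycSucc⇒~ (F.suc i) F.zero    _ | inj₁ ()
    cycSucc⇒~ (F.suc i) (F.suc j) _ | inj₁ eq = induced-consecutive path ind i j (suc-injective eq)
    cycSucc⇒~ F.zero    F.zero    _ | inj₂ (eq , _) = ⊥-elim (0≢1+n (suc-injective eq))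
    cycSucc⇒~ (F.suc i) F.zero    _ | inj₂ (eq , _) = ~-sym (end⇒v~ i (inj₂ (suc-injective eq)))
    cycSucc⇒~ _         (F.suc j) _ | inj₂ (_ , ())

    lookup-cycle-injective : ∀ i j → lookup cycle i ≡ lookup cycle j → i ≡ j
    lookup-cycle-injective F.zero    F.zero    _  = refl
    lookup-cycle-injective F.zero    (F.suc j) eq = ⊥-elim (v∉path j eq)
    lookup-cycle-injective (F.suc i) F.zero    eq = ⊥-elim (v∉path i (Eq.sym eq))
    lookup-cycle-injective (F.suc i) (F.suc j) eq = cong F.suc (lookup-injective path ind i j eq)

    length-cycle : length cycle ≡ 3 + length ys
    length-cycle = cong (suc ∘ suc) (length-∷ʳ ys w)

    cycle-hole : IsHole G (length cycle) (lookup cycle)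
    cycle-hole =
      subst (_≥ 4) (Eq.sym length-cycle) (s≤s (s≤s (s≤s ys≢[]))) ,
      (λ {i} {j} → lookup-cycle-injective i j) ,
      (λ i j → mk⇔ (~⇒cycSucc i j) [ cycSucc⇒~ i j , ~-sym ∘ cycSucc⇒~ j i ]′)
      where open Sum using ([_,_]′)

  no-long-cycle : ∀ {ℓ v y w} ys → NoLongHole G ℓ → ℓ ≤ 3 + length ys → Induced (y ∷ ys ++ [ w ]) →
                  v ~ y → v ~ w → ListAll (Apart v) ys → 1 ≤ length ys → ⊥
  no-long-cycle {ℓ} ys noHole ℓ≤ ind v~y v~w v#ys ys≢[] =
    noHole _ (subst (ℓ ≤_) (Eq.sym (length-cycle ys ind v~y v~w v#ys ys≢[])) ℓ≤) _
           (cycle-hole ys ind v~y v~w v#ys ys≢[])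

module Colourings {n : ℕ} (G : Graph n) where
  open Paths G
  open Levels G

  colourable-via : ∀ {Y : VSet n} {C : Set} {k} (enc : C → Fin k) → Injective _≡_ _≡_ enc →
                   (col : ∀ v → Y v → C) → (∀ u v yu yv → u ~ v → col u yu ≢ col v yv) → Colourable G Y k
  colourable-via enc enc-injective col proper =
    (λ v yv → enc (col v yv)) , (λ u v yu yv u~v eq → proper u v yu yv u~v (enc-injective eq))

  colourable-⊆ : ∀ {Y Z : VSet n} {k} → Y ⊆ Z → Colourable G Z k → Colourable G Y k
  colourable-⊆ Y⊆Z (c , proper) = (λ v yv → c v (Y⊆Z yv)) , (λ u v yu yv → proper u v (Y⊆Z yu) (Y⊆Z yv))

  colourable-≤ : ∀ {Y : VSet n} {k k′} → k ≤ k′ → Colourable G Y k → Colourable G Y k′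
  colourable-≤ k≤k′ (c , proper) =
    colourable-via (λ i → F.inject≤ i k≤k′) (λ {i} {j} → FinP.inject≤-injective k≤k′ k≤k′ i j) c proper

  root : V → V
  root z = choose z (λ x → within? x n z)

  root-connected : ∀ z → Connected (root z) z
  root-connected z = choose-satisfies z (λ x → within? x n z) (reach-mono z≤n refl)

  root-~ : ∀ {u v} → u ~ v → root u ≡ root v
  root-~ {u} {v} u~v =
    choose-cong u v (λ x → within? x n u) (λ x → within? x n v) (reach-mono z≤n refl) (step u~v) (step (~-sym u~v))
    where
      step : ∀ {u v x} → u ~ v → Connected x u → Connected x v
      step {u} {v} {x} u~v c = reach-≤n x (suc n) (inj₂ (tt , u , c , u~v))

  -- Vertices on consecutive levels get colours from different halves of the palette;
  -- vertices two or more levels apart are never adjacent.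
  colourable-by-levels : ∀ X → (∀ r j → Colourable G (Level r (suc j)) X) → Colourable G All (suc (X + X))
  colourable-by-levels X χ = (λ z _ → Φ z) , proper
    where
      colour : ∀ r d z → Level r d z → Fin (suc (X + X))
      colour r zero    z _  = F.zero
      colour r (suc j) z lz = F.suc (F.join X X (alternate j (proj₁ (χ r j) z lz)))

      colour-proper : ∀ r du dv u v (lu : Level r du u) (lv : Level r dv v) → u ~ v →
                      colour r du u lu ≢ colour r dv v lv
      colour-proper r zero     zero     u v lu lv u~v _ =
        ~⇒≢ u~v (trans (Eq.sym (level-zero lu)) (level-zero lv))
      colour-proper r zero     (suc jv) u v lu lv u~v ()
      colour-proper r (suc ju) zero     u v lu lv u~v ()
      colour-proper r (suc ju) (suc jv) u v lu lv u~v eq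
        with <-cmp ju jv | level-~≤ lu lv u~v | level-~≤ lv lu (~-sym u~v)
      ... | tri≈ _ refl _ | _ | _ =
        proj₂ (χ r ju) u v lu lv u~v (alternate-injective ju (join-injective X X (FinP.suc-injective eq)))
      ... | tri< ju<jv _ _ | jv≤ju+1 | _ with ≤-antisym ju<jv (≤-pred jv≤ju+1)
      ...   | refl = alternate-≢ ju (join-injective X X (FinP.suc-injective eq))
      colour-proper r (suc ju) (suc jv) u v lu lv u~v eq
          | tri> _ _ jv<ju | _ | ju≤jv+1 with ≤-antisym jv<ju (≤-pred ju≤jv+1)
      ...   | refl = alternate-≢ jv (Eq.sym (join-injective X X (FinP.suc-injective eq)))

      Φ : V → Fin (suc (X + X))
      Φ z = colour (root z) (dist (root z) z) z (level-of (root z) z (root-connected z))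

      proper : ∀ u v (_ _ : ⊤) → u ~ v → Φ u ≢ Φ v
      proper u v _ _ u~v with root u | root-connected u | root v | root-connected v | root-~ u~v
      ... | r | cu | .r | cv | refl = colour-proper r _ _ u v (level-of r u cu) (level-of r v cv) u~v

module OuterLevel {n : ℕ} (G : Graph n) {m κ τ : ℕ} (1≤m : 1 ≤ m) (noHole : NoLongHole G (3 + m))
                 (χN1 : ∀ v → Colourable G (N1 G v) κ) (χN2 : ∀ v → Colourable G (N2 G v) τ)
                 (r : Fin n) (k : ℕ) where
  open Paths G
  open Levels G
  open Holes G
  open Colourings G

  Inner Outer Below : V → Set
  Inner     = Level r (suc k)
  Outer     = Level r (suc (suc k))
  Below y   = ∃ λ j → j ≤ k × Level r j y

  level-≢ : ∀ {i j p q} → Level r i p → Level r j q → i ≢ j → p ≢ q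
  level-≢ lp lq i≢j refl = i≢j (level-unique lp lq)

  outer≢inner : ∀ {p q} → Outer p → Inner q → p ≢ q
  outer≢inner op iq = level-≢ op iq (1+n≢n)

  below≢inner : ∀ {p q} → Below p → Inner q → p ≢ q
  below≢inner (j , j≤k , lp) iq = level-≢ lp iq (λ j≡ → 1+n≰n (subst (_≤ k) j≡ j≤k))

  outer-apart-below : ∀ {p y} → Outer p → Below y → Apart p y
  outer-apart-below op (j , j≤k , ly) =
    level-≢ op ly (λ eq → 1+n≰n (≤-trans (≤-reflexive eq) (≤-trans j≤k (n≤1+n k)))) ,
    λ p~y → 1+n≰n (≤-trans (level-~≤ ly op (~-sym p~y)) (s≤s j≤k))

  down : ∀ j {y} → Level r j y → j ≤ suc k → Reach Below y j r
  down zero    ly _    = Eq.sym (level-zero ly)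
  down (suc j) ly j<k+2 with level-parent ly
  ... | p , lp , p~y = reach-∷ (~-sym p~y) (j , ≤-pred j<k+2 , lp) j (down j lp (≤-trans (n≤1+n j) j<k+2))

  up : ∀ j {y} → Level r j y → j ≤ k → Reach Below r j y
  up zero    ly _ = level-zero ly
  up (suc j) ly j<k+1 with level-parent ly
  ... | p , lp , p~y = inj₂ ((suc j , j<k+1 , ly) , p , up j lp (≤-trans (n≤1+n j) j<k+1) , p~y)

  -- Continue from q through the levels ≤ k (down to r, up to the parent of a) until the first
  -- vertex that sees a: with a and M this closes a hole of length at least m + 3.
  no-closing-path : ∀ {a q} → Inner a → Inner q → (M : List V) → ListAll Outer M → m ≤ length M →
                    Induced (a ∷ M ++ [ q ]) → ⊥
  no-closing-path _ _ [] _ m≤0 _ = 1+n≰n (≤-trans 1≤m m≤0)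
  no-closing-path {a} {q} ia iq (y ∷ Y) M-outer m≤|M| (a~y , a#Yq , ind)
    with level-parent ia
  ... | pa , lpa , pa~a
    with approach-to (λ by → below≢inner by ia) (λ q≡a → proj₁ a#q (Eq.sym q≡a))
           (route-to (y ∷ Y) q (λ by → ListAll.map (λ op → outer-apart-below op by) M-outer) ind
                     (k + suc k) (reach-++ (suc k) k (down (suc k) iq ≤-refl) (up k lpa ≤-refl)))
           pa~a
    where
      a#q : Apart a q
      a#q = ListAll.head (ListAllP.++⁻ʳ Y a#Yq)
  ... | approach before h ind′ starts ≢a misses h~a =
    no-long-cycle (Y ++ before) noHole length-ok
      (subst Induced (cong (y ∷_) (Eq.sym (++-assoc Y before [ h ]))) ind′)
      a~y (~-sym h~a)
      (ListAllP.++⁺ (ListAllP.++⁻ˡ Y a#Yq)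
        (ListAll.zipWith (λ (p≢a , p≁a) → (λ a≡p → p≢a (Eq.sym a≡p)) , (λ a~p → p≁a (~-sym a~p)))
          (ListAllP.++⁻ˡ before ≢a , misses)))
      (≤-trans 1≤before (length-++-≤ʳ before {Y}))
    where
      1≤before : 1 ≤ length before
      1≤before = head-∷ʳ-≢ before starts
        (λ h≡q → proj₂ (ListAll.head (ListAllP.++⁻ʳ Y a#Yq)) (~-sym (subst (_~ a) h≡q h~a)))

      length-ok : 3 + m ≤ 3 + length (Y ++ before)
      length-ok = +-monoʳ-≤ 3 (begin
        m                              ≤⟨ m≤|M| ⟩
        suc (length Y)                 ≡⟨ +-comm 1 (length Y) ⟩
        length Y + 1                   ≤⟨ +-monoʳ-≤ (length Y) 1≤before ⟩
        length Y + length before       ≡⟨ Eq.sym (length-++ Y) ⟩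
        length (Y ++ before)           ∎)
        where open ≤-Reasoning

  Region : List V → V → Pred V 0ℓ
  Region pre cur z = Outer z × ListAll (λ p → Apart p z) pre × cur ≢ z

  region? : ∀ pre cur → Decidable (Region pre cur)
  region? pre cur z = level? r _ z ×-dec (ListAll.all? (λ p → apart? p z) pre ×-dec ¬? (cur F.≟ z))

  Component : List V → V → Pred V 0ℓ
  Component pre cur z = Region pre cur z × Reach (Region pre cur) cur n z

  component? : ∀ pre cur → Decidable (Component pre cur)
  component? pre cur z = region? pre cur z ×-dec reach? (region? pre cur) cur n z

  component-~ : ∀ {pre cur u v} → Component pre cur u → u ~ v → Region pre cur v → Component pre cur v
  component-~ {cur = cur} (_ , reach) u~v rv = rv , reach-≤n cur (suc n) (inj₂ (rv , _ , reach , u~v))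

  region-shift : ∀ {pre cur x w} → cur ~ x → Region pre cur w → ¬ cur ~ w → Region (pre ++ [ cur ]) x w
  region-shift {cur = cur} cur~x (ow , pre#w , cur≢w) cur≁w =
    ow , ListAllP.++⁺ pre#w ((cur≢w , cur≁w) ∷ []) , (λ x≡w → cur≁w (subst (cur ~_) x≡w cur~x))

  Step : List V → V → V → Pred V 0ℓ
  Step pre cur z x = cur ~ x × Component pre cur x × Component (pre ++ [ cur ]) x z

  step? : ∀ pre cur z → Decidable (Step pre cur z)
  step? pre cur z x = adj? G cur x ×-dec (component? pre cur x ×-dec component? (pre ++ [ cur ]) x z)

  first-step : ∀ {pre cur z} j → Reach (Region pre cur) cur j z → Region pre cur z → ¬ cur ~ z →
          ∃ λ x → cur ~ x × Region pre cur x × Reach (Region (pre ++ [ cur ]) x) x j z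
  first-step zero refl (_ , _ , cur≢cur) _ = ⊥-elim (cur≢cur refl)
  first-step (suc j) (inj₁ reach) rz cur≁z =
    Product.map₂ (Product.map₂ (Product.map₂ inj₁)) (first-step j reach rz cur≁z)
  first-step {cur = cur} (suc j) (inj₂ (_ , w , reach , w~z)) rz cur≁z with adj? G cur w | reach-start j reach
  ... | yes cur~w | inj₁ refl = ⊥-elim (irrefl G cur~w)
  ... | yes cur~w | inj₂ rw   =
    w , cur~w , rw , reach-mono (s≤s z≤n) (inj₂ (region-shift cur~w rz cur≁z , w , refl , w~z))
  ... | no cur≁w  | inj₁ refl = ⊥-elim (cur≁z w~z)
  ... | no cur≁w  | inj₂ rw with first-step j reach rw cur≁w
  ...   | x , cur~x , rx , reach′ = x , cur~x , rx , inj₂ (region-shift cur~x rz cur≁z , w , reach′ , w~z)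

  step-exists : ∀ {pre cur z} → Component pre cur z → ¬ cur ~ z → ∃ (Step pre cur z)
  step-exists {cur = cur} (rz , reach) cur≁z with first-step n reach rz cur≁z
  ... | x , cur~x , rx , reach′ =
    x , cur~x , (rx , reach-≤n cur 1 (inj₂ (rx , cur , refl , cur~x))) , (region-shift cur~x rz cur≁z , reach′)

  next : List V → V → V → V
  next pre cur z = choose cur (step? pre cur z)

  next-step : ∀ {pre cur z} → Component pre cur z → ¬ cur ~ z → Step pre cur z (next pre cur z)
  next-step {pre} {cur} {z} cz cur≁z = choose-satisfies cur (step? pre cur z) (proj₂ (step-exists cz cur≁z))

  next-~ : ∀ {pre cur u v} → Component pre cur u → Component pre cur v → ¬ cur ~ u → ¬ cur ~ v → u ~ v →
           next pre cur u ≡ next pre cur v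
  next-~ {pre} {cur} {u} {v} cu cv cur≁u cur≁v u~v =
    choose-cong cur cur (step? pre cur u) (step? pre cur v) (proj₂ (step-exists cu cur≁u))
      (shift cv cur≁v u~v) (shift cu cur≁u (~-sym u~v))
    where
      shift : ∀ {u v x} → Component pre cur v → ¬ cur ~ v → u ~ v → Step pre cur u x → Step pre cur v x
      shift (rv , _) cur≁v u~v (cur~x , cx , cxu) = cur~x , cx , component-~ cxu u~v (region-shift cur~x rv cur≁v)

  data Shape (a : V) : List V → V → Set where
    start : Shape a [] a
    grown : ∀ {tp cur} → ListAll Outer tp → Outer cur → Shape a (a ∷ tp) cur

  record Trail (a : V) (pre : List V) (cur : V) : Set where
    constructor trail
    field
      inner   : Inner a
      induced : Induced (pre ++ [ cur ])
      shape   : Shape a pre cur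

  trail-step : ∀ {a pre cur x} → Trail a pre cur → cur ~ x → Region pre cur x → Trail a (pre ++ [ cur ]) x
  trail-step {pre = pre} {cur} {x} (trail ia ind sh) cur~x (ox , pre#x , _) =
    trail ia (subst Induced (Eq.sym (++-assoc pre [ cur ] [ x ])) (induced-∷ʳ pre ind pre#x cur~x)) (grow sh)
    where
      grow : ∀ {pre cur} → Shape _ pre cur → Shape _ (pre ++ [ cur ]) x
      grow start                  = grown [] ox
      grow (grown {tp} otp ocur) = grown (ListAllP.++⁺ otp (ocur ∷ [])) ox

  -- If no vertex of the trail is at distance two from z, the trail runs on inside the
  -- component to a neighbour of the parent q of z, giving an induced path from a to q.
  outer-detour : ∀ {a pre cur z} → Trail a pre cur → length pre ≡ m → Component pre cur z →
                 ListAll (λ p → ¬ N2 G p z) pre →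
                 ∃ λ q → Inner q × ∃ λ M → ListAll Outer M × m ≤ length M × Induced (a ∷ M ++ [ q ])
  outer-detour (trail _ _ start) |pre|≡m _ _ = ⊥-elim (1+n≰n (≤-trans 1≤m (≤-reflexive (Eq.sym |pre|≡m))))
  outer-detour {a} {a ∷ tp} {cur} {z} (trail ia ind (grown otp ocur)) |pre|≡m (rz , reach) ¬N2
    with level-parent (proj₁ rz)
  ... | q , iq , q~z
    with approach-to proj₁ ocur (route-to (a ∷ tp) cur (λ ry → proj₁ (proj₂ ry)) ind n reach) (~-sym q~z)
  ... | approach before h ind′ _ obh misses h~q =
    q , iq , tp ++ before ++ [ h ] , ListAllP.++⁺ otp obh , length-ok ,
    subst Induced (cong (a ∷_) (Eq.sym (trans (++-assoc tp (before ++ [ h ]) [ q ])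
                                           (cong (tp ++_) (++-assoc before [ h ] [ q ])))))
      (induced-++-∷ʳ (a ∷ tp) before ind′
        (ListAllP.++⁺ (ListAll.zipWith (λ (p#z , ¬N2p) → apart-from-neighbour p#z ¬N2p q~z)
                                        (proj₁ (proj₂ rz) , ¬N2))
                      (ListAll.zipWith (λ (op , p≁q) → outer≢inner op iq , p≁q)
                                        (ListAllP.++⁻ˡ before obh , misses)))
        h~q)
    where
      length-ok : m ≤ length (tp ++ before ++ [ h ])
      length-ok = begin
        m                                     ≡⟨ Eq.sym |pre|≡m ⟩
        suc (length tp)                       ≡⟨ +-comm 1 (length tp) ⟩
        length tp + 1                         ≤⟨ +-monoʳ-≤ (length tp) 1≤|before∷ʳh| ⟩
        length tp + length (before ++ [ h ])  ≡⟨ Eq.sym (length-++ tp) ⟩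
        length (tp ++ before ++ [ h ])        ∎
        where
          open ≤-Reasoning
          1≤|before∷ʳh| : 1 ≤ length (before ++ [ h ])
          1≤|before∷ʳh| = subst (1 ≤_) (Eq.sym (length-∷ʳ before h)) (s≤s z≤n)

  distance-two : ∀ {a pre cur z} → Trail a pre cur → length pre ≡ m → Component pre cur z →
                 Any (λ p → N2 G p z) pre
  distance-two {pre = pre} {z = z} t |pre|≡m cz with Any.any? (λ p → n2? p z) pre
  ... | yes any = any
  ... | no ¬any with outer-detour t |pre|≡m cz (ListAllP.¬Any⇒All¬ pre ¬any)
  ...   | q , iq , M , oM , m≤|M| , ind = ⊥-elim (no-closing-path (Trail.inner t) iq M oM m≤|M| ind)

  n2-colour : ∀ pre {z} → Any (λ p → N2 G p z) pre → Fin (length pre) × Fin τ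
  n2-colour (p ∷ _)  (here z∈N2) = F.zero , proj₁ (χN2 p) _ z∈N2
  n2-colour (_ ∷ ps) (there any) = Product.map₁ F.suc (n2-colour ps any)

  n2-colour-proper : ∀ pre {u v} (au : Any (λ p → N2 G p u) pre) (av : Any (λ p → N2 G p v) pre) → u ~ v →
                     n2-colour pre au ≢ n2-colour pre av
  n2-colour-proper (p ∷ _)  (here u∈N2) (here v∈N2) u~v eq = proj₂ (χN2 p) _ _ u∈N2 v∈N2 u~v (cong proj₂ eq)
  n2-colour-proper (_ ∷ _)  (here _)    (there _)   _   eq with cong proj₁ eq
  ... | ()
  n2-colour-proper (_ ∷ _)  (there _)   (here _)    _   eq with cong proj₁ eq
  ... | ()
  n2-colour-proper (_ ∷ ps) (there au)  (there av)  u~v eq =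
    n2-colour-proper ps au av u~v (cong₂ _,_ (FinP.suc-injective (cong proj₁ eq)) (cong proj₂ eq))

  -- In Tag m, (i , c) on the left is an N¹-colour and on the right an N²-colour of the i-th trail vertex.
  Tag : ℕ → Set
  Tag d = (Fin d × Fin κ) ⊎ (Fin m × Fin τ)

  deeper : ∀ {d} → Tag d → Tag (suc d)
  deeper = Sum.map₁ (Product.map₁ F.suc)

  deeper-injective : ∀ {d} {s t : Tag d} → deeper s ≡ deeper t → s ≡ t
  deeper-injective {s = inj₁ _} {inj₁ _} refl = refl
  deeper-injective {s = inj₂ _} {inj₂ _} refl = refl

  here≢deeper : ∀ {d} {c : Fin κ} (t : Tag d) → inj₁ (F.zero , c) ≢ deeper t
  here≢deeper (inj₁ _) ()
  here≢deeper (inj₂ _) ()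

  length-step : ∀ pre (cur : V) d → length pre + suc d ≡ m → length (pre ++ [ cur ]) + d ≡ m
  length-step pre cur d eq = trans (cong (_+ d) (length-∷ʳ pre cur)) (trans (Eq.sym (+-suc (length pre) d)) eq)

  -- Extend the trail towards z until its last vertex sees z, or until it has m vertices,
  -- when some trail vertex is at distance two from z.
  mutual
    tag : ∀ {a} pre cur d z → Trail a pre cur → length pre + d ≡ m → Component pre cur z → Tag d
    tag pre cur zero z t len cz =
      inj₂ (Product.map₁ (F.cast len′) (n2-colour pre (distance-two t len′ cz)))
      where len′ = trans (Eq.sym (+-identityʳ (length pre))) len
    tag pre cur (suc d) z t len cz with adj? G cur z
    ... | yes cur~z = inj₁ (F.zero , proj₁ (χN1 cur) z cur~z)
    ... | no  cur≁z = deeper (descend pre cur d z t len (next pre cur z) (next-step cz cur≁z))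

    descend : ∀ {a} pre cur d z → Trail a pre cur → length pre + suc d ≡ m → ∀ x → Step pre cur z x → Tag d
    descend pre cur d z t len x (cur~x , cx , cxz) =
      tag (pre ++ [ cur ]) x d z (trail-step t cur~x (proj₁ cx)) (length-step pre cur d len) cxz

  mutual
    tag-proper : ∀ {a} pre cur d {u v} (tu tv : Trail a pre cur) (lu lv : length pre + d ≡ m)
                 (cu : Component pre cur u) (cv : Component pre cur v) → u ~ v →
                 tag pre cur d u tu lu cu ≢ tag pre cur d v tv lv cv
    tag-proper pre cur zero tu tv lu lv cu cv u~v eq =
      n2-colour-proper pre _ _ u~v
        (cong₂ _,_ (cast-injective lu′ (cong proj₁ (inj₂-injective eq))) (cong proj₂ (inj₂-injective eq)))
      where lu′ = trans (Eq.sym (+-identityʳ (length pre))) lu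
    tag-proper pre cur (suc d) {u} {v} tu tv lu lv cu cv u~v with adj? G cur u | adj? G cur v
    ... | yes cur~u | yes cur~v = λ eq →
      proj₂ (χN1 cur) u v cur~u cur~v u~v (cong proj₂ (inj₁-injective eq))
    ... | yes _     | no  cur≁v = here≢deeper (descend pre cur d v tv lv _ (next-step cv cur≁v))
    ... | no  cur≁u | yes _     = here≢deeper (descend pre cur d u tu lu _ (next-step cu cur≁u)) ∘ Eq.sym
    ... | no  cur≁u | no  cur≁v
      with next pre cur u | next-step cu cur≁u | next pre cur v | next-step cv cur≁v
         | next-~ cu cv cur≁u cur≁v u~v
    ...  | x | su | .x | sv | refl = descend-proper pre cur d tu tv lu lv x su sv u~v ∘ deeper-injective

    descend-proper : ∀ {a} pre cur d {u v} (tu tv : Trail a pre cur) (lu lv : length pre + suc d ≡ m) x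
                     (su : Step pre cur u x) (sv : Step pre cur v x) → u ~ v →
                     descend pre cur d u tu lu x su ≢ descend pre cur d v tv lv x sv
    descend-proper pre cur d tu tv lu lv x (cur~x , cx , cxu) (cur~x′ , cx′ , cxv) u~v =
      tag-proper (pre ++ [ cur ]) x d _ _ _ _ cxu cxv u~v

  Top : V → Pred V 0ℓ
  Top z x = Inner x × Component [] x z

  top? : ∀ z → Decidable (Top z)
  top? z x = level? r _ x ×-dec component? [] x z

  top : V → V
  top z = choose r (top? z)

  outer-region : ∀ {x z} → Outer z → Inner x → Region [] x z
  outer-region oz ix = oz , [] , (λ x≡z → outer≢inner oz ix (Eq.sym x≡z))

  parent-top : ∀ {z} → Outer z → ∃ (Top z)
  parent-top oz with level-parent oz
  ... | a , ia , a~z = a , ia , outer-region oz ia , reach-≤n a 1 (inj₂ (outer-region oz ia , a , refl , a~z))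

  top-spec : ∀ {z} → Outer z → Top z (top z)
  top-spec {z} oz = choose-satisfies r (top? z) (proj₂ (parent-top oz))

  top-~ : ∀ {u v} → Outer u → Outer v → u ~ v → top u ≡ top v
  top-~ {u} {v} ou ov u~v =
    choose-cong r r (top? u) (top? v) (proj₂ (parent-top ou)) (shift ov u~v) (shift ou (~-sym u~v))
    where
      shift : ∀ {u v x} → Outer v → u ~ v → Top u x → Top v x
      shift ov u~v (ix , cx) = ix , component-~ cx u~v (outer-region ov ix)

  outer-tag : ∀ z → Outer z → Tag m
  outer-tag z oz = tag [] (top z) m z (trail (proj₁ (top-spec oz)) tt start) refl (proj₂ (top-spec oz))

  encode : Tag m → Fin (m * κ + m * τ)
  encode = F.join (m * κ) (m * τ) ∘ Sum.map (Product.uncurry F.combine) (Product.uncurry F.combine)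

  encode-injective : Injective _≡_ _≡_ encode
  encode-injective {inj₁ (i , c)} {inj₁ (i′ , c′)} eq
    with FinP.combine-injective i c i′ c′ (inj₁-injective (join-injective (m * κ) (m * τ) eq))
  ... | refl , refl = refl
  encode-injective {inj₂ (i , c)} {inj₂ (i′ , c′)} eq
    with FinP.combine-injective i c i′ c′ (inj₂-injective (join-injective (m * κ) (m * τ) eq))
  ... | refl , refl = refl
  encode-injective {inj₁ (i , c)} {inj₂ (i′ , c′)} eq
    with join-injective (m * κ) (m * τ) {inj₁ (F.combine i c)} {inj₂ (F.combine i′ c′)} eq
  ... | ()
  encode-injective {inj₂ (i , c)} {inj₁ (i′ , c′)} eq
    with join-injective (m * κ) (m * τ) {inj₂ (F.combine i c)} {inj₁ (F.combine i′ c′)} eq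
  ... | ()

  colourable : Colourable G Outer (m * κ + m * τ)
  colourable = colourable-via encode encode-injective outer-tag proper
    where
      proper : ∀ u v ou ov → u ~ v → outer-tag u ou ≢ outer-tag v ov
      proper u v ou ov u~v with top u | top-spec ou | top v | top-spec ov | top-~ ou ov u~v
      ... | x | (ix , cu) | .x | (ix′ , cv) | refl =
        tag-proper [] x m (trail ix tt start) (trail ix′ tt start) refl refl cu cv u~v

palette : ∀ m κ τ → 2 * m * (κ + τ) ≡ (m * κ + m * τ) + (m * κ + m * τ)
palette = solve-∀

mainTheorem11 : (ℓ κ τ : ℕ) → ℓ ≥ 4 → (n : ℕ) → (G : Graph n) →
    NoLongHole G ℓ →
    (∀ v → χ≤ G (N1 G v) κ) →
    (∀ v → χ≤ G (N2 G v) τ) →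
    χ≤ G All (suc (2 * (ℓ ∸ 3) * (κ + τ)))
mainTheorem11 ℓ κ τ ℓ≥4 n G noHole χN1 χN2 =
  subst (χ≤ G All ∘ suc) (Eq.sym (palette (ℓ ∸ 3) κ τ)) (colourable-by-levels X level-colourable)
  where
    open Paths G
    open Levels G
    open Colourings G

    m X : ℕ
    m = ℓ ∸ 3
    X = m * κ + m * τ

    1≤m : 1 ≤ m
    1≤m = ∸-monoˡ-≤ 3 ℓ≥4

    noHole′ : NoLongHole G (3 + m)
    noHole′ = subst (NoLongHole G) (Eq.sym (m+[n∸m]≡n (≤-trans (n≤1+n 3) ℓ≥4))) noHole

    κ≤X : κ ≤ X
    κ≤X = ≤-trans (≤-trans (≤-reflexive (Eq.sym (*-identityˡ κ))) (*-monoˡ-≤ κ 1≤m)) (m≤m+n (m * κ) (m * τ))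

    level-colourable : ∀ r j → Colourable G (Level r (suc j)) X
    level-colourable r zero    = colourable-≤ κ≤X (colourable-⊆ level-one (χN1 r))
    level-colourable r (suc k) = OuterLevel.colourable G 1≤m noHole′ χN1 χN2 r k
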